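{- Let $G$ be a graph in which every vertex belongs to a simplicial clique, and let $S$ be a degree-greedy stable set in $G$. Then every vertex of $S$ is simplicial, and $S$ contains exactly one vertex from each simplicial clique of $G$.
   Context: A vertex $v$ is simplicial if $N[v]$ is a clique; a simplicial clique is a clique equal to $N[v]$ for some simplicial vertex $v$. For a linear ordering $\sigma=(v_1,\dots,v_n)$ of $V(G)$, the $\sigma$-greedy stable set is obtained by scanning $v_1,\dots,v_n$ in order, starting from $S=\emptyset$, and adding $v_i$ to $S$ whenever $S\cup\{v_i\}$ is still stable. A degree-greedy stable set is a $\sigma$-greedy stable set for some ordering $\sigma$ with $d_G(v_i)\le d_G(v_j)$ whenever $i<j$ (degrees taken in $G$ itself). -}

module Defs where

open import Data.Nat using (ℕ; _≤_; _<_)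
open import Data.Bool using (Bool; true; false; if_then_else_)
open import Data.Fin using (Fin; toℕ)
open import Data.List using (List; []; _∷_; _++_; map)
open import Data.Nat.ListAction using (sum)
open import Data.Bool.ListAction using (any)
open import Data.List.Base using (allFin)
open import Data.List.Membership.Propositional using (_∈_)
open import Data.Product using (Σ; ∃; _×_; _,_)
open import Data.Sum using (_⊎_)
open import Relation.Binary.PropositionalEquality using (_≡_; _≢_)
open import Relation.Nullary using (¬_)
open import Function.Definitions using (Injective)

record Graph (n : ℕ) : Set where
  field
    adj   : Fin n → Fin n → Bool
    sym   : ∀ u v → adj u v ≡ adj v u
    irrefl : ∀ v → adj v v ≡ false

open Graph public

module _ {n : ℕ} (G : Graph n) where

  Adj : Fin n → Fin n → Set
  Adj u v = adj G u v ≡ true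

  ClosedNbhd : Fin n → Fin n → Set
  ClosedNbhd v u = u ≡ v ⊎ Adj v u

  IsClique : (Fin n → Set) → Set
  IsClique C = ∀ u w → C u → C w → u ≢ w → Adj u w

  IsStable : (Fin n → Set) → Set
  IsStable S = ∀ u w → S u → S w → ¬ Adj u w

  Simplicial : Fin n → Set
  Simplicial v = IsClique (ClosedNbhd v)

  SimplicialClique : (Fin n → Set) → Set
  SimplicialClique C = ∃ λ v → Simplicial v × (∀ u → (C u → ClosedNbhd v u) × (ClosedNbhd v u → C u))

  degree : Fin n → ℕ
  degree v = sum (map (λ w → if adj G v w then 1 else 0) (allFin n))

  -- greedy scan: add v to S iff S ∪ {v} is still stable, i.e. v has no
  -- neighbour in S (vertices of an ordering are distinct, so v ∉ S).
  greedyScan : List (Fin n) → List (Fin n) → List (Fin n)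
  greedyScan S []       = S
  greedyScan S (v ∷ vs) =
    if any (adj G v) S then greedyScan S vs else greedyScan (S ++ (v ∷ [])) vs

  -- σ-greedy stable set for an ordering σ : Fin n → Fin n (σ i = v_{i+1})
  greedySet : (Fin n → Fin n) → List (Fin n)
  greedySet σ = greedyScan [] (map σ (allFin n))

  -- σ is a linear ordering of V(G) (a bijection; injective suffices on Fin n)
  -- with non-decreasing degrees
  DegreeOrdering : (Fin n → Fin n) → Set
  DegreeOrdering σ = Injective _≡_ _≡_ σ × (∀ i j → toℕ i < toℕ j → degree (σ i) ≤ degree (σ j))

  DegreeGreedy : (Fin n → Set) → Set
  DegreeGreedy S = ∃ λ σ → DegreeOrdering σ × (∀ v → (S v → v ∈ greedySet σ) × (v ∈ greedySet σ → S v))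

-- A vertex v of the greedy set lies in N[s] for some simplicial s; if v ≠ s, simpliciality of s
-- gives N[s] ⊆ N[v]. Were this inclusion strict, s would have smaller degree than v and so be
-- scanned earlier; the vertex of N[s] that the scan has picked by then lies in N[v] and is not v,
-- so it blocks v. Hence N[v] = N[s] is a clique. For the second part, the greedy set dominates
-- every vertex, so it meets each N[s], and being stable it meets the clique N[s] only once.
module Submission where

open import Defs hiding (sym)
open import Algebra.Properties.CommutativeSemigroup using (interchange)
open import Data.Bool using (Bool; true; false; if_then_else_)
open import Data.Bool.ListAction using (any)
import Data.Bool.Properties as Bool
open import Data.Empty using (⊥-elim)
open import Data.Fin using (Fin; toℕ; zero; suc; punchOut)
open import Data.Fin.Properties using (_≟_; toℕ-injective; punchOut-injective; injective⇒≤; any?)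
open import Data.List using (List; []; _∷_; [_]; _++_; map; take; drop; tabulate; allFin)
open import Data.List.Membership.Propositional using (_∈_; _∉_)
open import Data.List.Membership.Propositional.Properties using (∈-++⁻; ∈-++⁺ˡ; ∈-++⁺ʳ; ∈-map⁺; ∈-allFin)
open import Data.List.Properties using (map-tabulate; take++drop≡id; tabulate-cong)
open import Data.List.Relation.Unary.Any using (here; there)
open import Data.Nat using (ℕ; zero; suc; _+_; _≤_; _<_; z≤n; s≤s)
open import Data.Nat.ListAction using (sum)
open import Data.Nat.Properties
  using (+-mono-≤; +-mono-<-≤; +-mono-≤-<; +-commutativeSemigroup; ≤-refl; ≤-pred; <-irrefl; <⇒≱; <-cmp)
open import Data.Product using (∃; _×_; _,_; proj₁; proj₂)
open import Data.Sum using (_⊎_; inj₁; inj₂)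
open import Level using (0ℓ)
open import Function using (_∘_; id)
open import Function.Definitions using (Injective)
open import Relation.Binary using (tri<; tri≈; tri>)
open import Relation.Binary.PropositionalEquality
  using (_≡_; _≢_; refl; sym; trans; cong; cong₂; subst; subst₂; module ≡-Reasoning)
open import Relation.Nullary using (¬_; Dec; does; yes; no; _⊎-dec_)
open import Relation.Unary using (Pred; Decidable; _⊆_)

sumFin : ∀ {m} → (Fin m → ℕ) → ℕ
sumFin f = sum (tabulate f)

sumFin-mono-≤ : ∀ {m} {f g : Fin m → ℕ} → (∀ w → f w ≤ g w) → sumFin f ≤ sumFin g
sumFin-mono-≤ {zero}  f≤g = z≤n
sumFin-mono-≤ {suc m} f≤g = +-mono-≤ (f≤g zero) (sumFin-mono-≤ (f≤g ∘ suc))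

sumFin-mono-< : ∀ {m} {f g : Fin m → ℕ} → (∀ w → f w ≤ g w) → ∀ x → f x < g x → sumFin f < sumFin g
sumFin-mono-< f≤g zero    fx<gx = +-mono-<-≤ fx<gx (sumFin-mono-≤ (f≤g ∘ suc))
sumFin-mono-< f≤g (suc x) fx<gx = +-mono-≤-< (f≤g zero) (sumFin-mono-< (f≤g ∘ suc) x fx<gx)

sumFin-+ : ∀ {m} (f g : Fin m → ℕ) → sumFin (λ w → f w + g w) ≡ sumFin f + sumFin g
sumFin-+ {zero}  f g = refl
sumFin-+ {suc m} f g = begin
  (f zero + g zero) + sumFin (λ w → f (suc w) + g (suc w))  ≡⟨ cong (f zero + g zero +_) (sumFin-+ (f ∘ suc) (g ∘ suc)) ⟩
  (f zero + g zero) + (sumFin (f ∘ suc) + sumFin (g ∘ suc)) ≡⟨ interchange +-commutativeSemigroup (f zero) (g zero) _ _ ⟩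
  sumFin f + sumFin g                                        ∎
  where open ≡-Reasoning

sumFin-zero : ∀ m → sumFin {m} (λ _ → 0) ≡ 0
sumFin-zero zero    = refl
sumFin-zero (suc m) = sumFin-zero m

indicator : ∀ {A : Set} → Dec A → ℕ
indicator a? = if does a? then 1 else 0

count : ∀ {m} {P : Pred (Fin m) 0ℓ} → Decidable P → ℕ
count P? = sumFin (λ w → indicator (P? w))

module _ {m : ℕ} {P Q : Pred (Fin m) 0ℓ} (P? : Decidable P) (Q? : Decidable Q) where

  count-mono-< : P ⊆ Q → ∀ {x} → Q x → ¬ P x → count P? < count Q?
  count-mono-< P⊆Q {x} Qx ¬Px = sumFin-mono-< indicator-mono x indicator-<
    where
    indicator-mono : ∀ w → indicator (P? w) ≤ indicator (Q? w)
    indicator-mono w with P? w | Q? w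
    ... | yes _  | yes _  = ≤-refl
    ... | yes Pw | no ¬Qw = ⊥-elim (¬Qw (P⊆Q Pw))
    ... | no _   | _      = z≤n
    indicator-< : indicator (P? x) < indicator (Q? x)
    indicator-< with P? x | Q? x
    ... | yes Px | _      = ⊥-elim (¬Px Px)
    ... | no _   | yes _  = s≤s z≤n
    ... | no _   | no ¬Qx = ⊥-elim (¬Qx Qx)

  count-⊎ : (∀ {x} → P x → ¬ Q x) → count (λ x → P? x ⊎-dec Q? x) ≡ count P? + count Q?
  count-⊎ disjoint = trans (cong sum (tabulate-cong indicator-⊎)) (sumFin-+ (indicator ∘ P?) (indicator ∘ Q?))
    where
    indicator-⊎ : ∀ w → indicator (P? w ⊎-dec Q? w) ≡ indicator (P? w) + indicator (Q? w)
    indicator-⊎ w with P? w | Q? w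
    ... | yes Pw | yes Qw = ⊥-elim (disjoint Pw Qw)
    ... | yes _  | no _   = refl
    ... | no _   | yes _  = refl
    ... | no _   | no _   = refl

count-≡ : ∀ {m} (a : Fin m) → count (_≟ a) ≡ 1
count-≡ {suc m} zero    = cong suc (sumFin-zero m)
count-≡ {suc m} (suc a) = count-≡ a

injective⇒surjective : ∀ {m} {f : Fin m → Fin m} → Injective _≡_ _≡_ f → ∀ y → ∃ λ x → f x ≡ y
injective⇒surjective {suc m} {f} f-inj y with any? (λ x → f x ≟ y)
... | yes hit = hit
... | no miss = ⊥-elim (<⇒≱ ≤-refl (injective⇒≤ punchOut∘f-injective))
  where
  f≢y : ∀ x → y ≢ f x
  f≢y x y≡fx = miss (x , sym y≡fx)
  punchOut∘f-injective : Injective _≡_ _≡_ (λ x → punchOut (f≢y x))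
  punchOut∘f-injective {x} {x′} eq = f-inj (punchOut-injective (f≢y x) (f≢y x′) eq)

any≡true⇒∃ : ∀ {A : Set} (p : A → Bool) xs → any p xs ≡ true → ∃ λ x → x ∈ xs × p x ≡ true
any≡true⇒∃ p (x ∷ xs) hit with p x in px
... | true  = x , here refl , px
... | false with any≡true⇒∃ p xs hit
...   | y , y∈xs , py = y , there y∈xs , py

any≡false⇒∀ : ∀ {A : Set} (p : A → Bool) xs → any p xs ≡ false → ∀ {x} → x ∈ xs → p x ≢ true
any≡false⇒∀ p (y ∷ xs) miss x∈ with p y in py
any≡false⇒∀ p (y ∷ xs) ()   x∈          | true
any≡false⇒∀ p (y ∷ xs) miss (here refl) | false rewrite py = λ ()
any≡false⇒∀ p (y ∷ xs) miss (there x∈)  | false = any≡false⇒∀ p xs miss x∈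

∈-take-tabulate⁺ : ∀ {A : Set} {m} (f : Fin m → A) (i : Fin m) → f i ∈ take (suc (toℕ i)) (tabulate f)
∈-take-tabulate⁺ f zero    = here refl
∈-take-tabulate⁺ f (suc i) = there (∈-take-tabulate⁺ (f ∘ suc) i)

∈-take-tabulate⁻ : ∀ {A : Set} {m} (f : Fin m → A) k {x} → x ∈ take k (tabulate f) → ∃ λ j → toℕ j < k × x ≡ f j
∈-take-tabulate⁻ {m = suc m} f (suc k) (here x≡f0) = zero , s≤s z≤n , x≡f0
∈-take-tabulate⁻ {m = suc m} f (suc k) (there x∈) with ∈-take-tabulate⁻ (f ∘ suc) k x∈
... | j , j<k , x≡fj = suc j , s≤s j<k , x≡fj

module _ {n : ℕ} (G : Graph n) where

  Adj-irrefl : ∀ v → ¬ Adj G v v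
  Adj-irrefl v vv with trans (sym (irrefl G v)) vv
  ... | ()

  Adj? : ∀ v → Decidable (Adj G v)
  Adj? v w = adj G v w Bool.≟ true

  ClosedNbhd? : ∀ v → Decidable (ClosedNbhd G v)
  ClosedNbhd? v w = w ≟ v ⊎-dec Adj? v w

  degree≡count : ∀ v → degree G v ≡ count (Adj? v)
  degree≡count v = cong sum (trans (map-tabulate id _) (tabulate-cong adj-indicator))
    where
    adj-indicator : ∀ w → (if adj G v w then 1 else 0) ≡ indicator (Adj? v w)
    adj-indicator w with adj G v w
    ... | true  = refl
    ... | false = refl

  count-ClosedNbhd : ∀ v → count (ClosedNbhd? v) ≡ suc (degree G v)
  count-ClosedNbhd v = begin
    count (ClosedNbhd? v)           ≡⟨ count-⊎ (_≟ v) (Adj? v) (λ { refl → Adj-irrefl v }) ⟩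
    count (_≟ v) + count (Adj? v)   ≡⟨ cong₂ _+_ (count-≡ v) (sym (degree≡count v)) ⟩
    suc (degree G v)                ∎
    where open ≡-Reasoning

  ClosedNbhd-⊂⇒degree-< : ∀ {s v x} → ClosedNbhd G s ⊆ ClosedNbhd G v → ClosedNbhd G v x → ¬ ClosedNbhd G s x →
                          degree G s < degree G v
  ClosedNbhd-⊂⇒degree-< {s} {v} N[s]⊆N[v] x∈N[v] x∉N[s] =
    ≤-pred (subst₂ _<_ (count-ClosedNbhd s) (count-ClosedNbhd v)
                       (count-mono-< (ClosedNbhd? s) (ClosedNbhd? v) N[s]⊆N[v] x∈N[v] x∉N[s]))

  Simplicial⇒ClosedNbhd-⊆ : ∀ {s v} → Simplicial G s → Adj G s v → ClosedNbhd G s ⊆ ClosedNbhd G v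
  Simplicial⇒ClosedNbhd-⊆ {v = v} simp sv {u} u∈N[s] with u ≟ v
  ... | yes u≡v = inj₁ u≡v
  ... | no u≢v  = inj₂ (simp v u (inj₂ sv) u∈N[s] (u≢v ∘ sym))

  IsStable-∷ʳ : ∀ S v → IsStable G (_∈ S) → any (adj G v) S ≡ false → IsStable G (_∈ S ++ [ v ])
  IsStable-∷ʳ S v S-stable v-isolated u w u∈ w∈ with ∈-++⁻ S u∈ | ∈-++⁻ S w∈
  ... | inj₁ u∈S         | inj₁ w∈S         = S-stable u w u∈S w∈S
  ... | inj₁ u∈S         | inj₂ (here refl) = any≡false⇒∀ (adj G v) S v-isolated u∈S ∘ trans (Graph.sym G v u)
  ... | inj₂ (here refl) | inj₁ w∈S         = any≡false⇒∀ (adj G v) S v-isolated w∈S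
  ... | inj₂ (here refl) | inj₂ (here refl) = Adj-irrefl v

  greedyScan-++ : ∀ S xs ys → greedyScan G S (xs ++ ys) ≡ greedyScan G (greedyScan G S xs) ys
  greedyScan-++ S []       ys = refl
  greedyScan-++ S (x ∷ xs) ys with any (adj G x) S
  ... | true  = greedyScan-++ S xs ys
  ... | false = greedyScan-++ (S ++ [ x ]) xs ys

  greedyScan-⊇ : ∀ S vs {u} → u ∈ S → u ∈ greedyScan G S vs
  greedyScan-⊇ S []       u∈S = u∈S
  greedyScan-⊇ S (x ∷ vs) u∈S with any (adj G x) S
  ... | true  = greedyScan-⊇ S vs u∈S
  ... | false = greedyScan-⊇ (S ++ [ x ]) vs (∈-++⁺ˡ u∈S)

  greedyScan-⊆ : ∀ S vs {u} → u ∈ greedyScan G S vs → u ∈ S ⊎ u ∈ vs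
  greedyScan-⊆ S []       u∈ = inj₁ u∈
  greedyScan-⊆ S (x ∷ vs) u∈ with any (adj G x) S
  ... | true with greedyScan-⊆ S vs u∈
  ...   | inj₁ u∈S  = inj₁ u∈S
  ...   | inj₂ u∈vs = inj₂ (there u∈vs)
  greedyScan-⊆ S (x ∷ vs) u∈ | false with greedyScan-⊆ (S ++ [ x ]) vs u∈
  ...   | inj₂ u∈vs = inj₂ (there u∈vs)
  ...   | inj₁ u∈S++x with ∈-++⁻ S u∈S++x
  ...     | inj₁ u∈S        = inj₁ u∈S
  ...     | inj₂ (here u≡x) = inj₂ (here u≡x)

  greedyScan-stable : ∀ S vs → IsStable G (_∈ S) → IsStable G (_∈ greedyScan G S vs)
  greedyScan-stable S []       S-stable = S-stable
  greedyScan-stable S (x ∷ vs) S-stable with any (adj G x) S in x-nbrs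
  ... | true  = greedyScan-stable S vs S-stable
  ... | false = greedyScan-stable (S ++ [ x ]) vs (IsStable-∷ʳ S x S-stable x-nbrs)

  greedyScan-dominates : ∀ S vs {u} → u ∈ vs → ∃ λ w → w ∈ greedyScan G S vs × ClosedNbhd G u w
  greedyScan-dominates S (x ∷ vs) (there u∈vs) with any (adj G x) S
  ... | true  = greedyScan-dominates S vs u∈vs
  ... | false = greedyScan-dominates (S ++ [ x ]) vs u∈vs
  greedyScan-dominates S (x ∷ vs) (here refl) with any (adj G x) S in x-nbrs
  ... | true with any≡true⇒∃ (adj G x) S x-nbrs
  ...   | w , w∈S , xw = w , greedyScan-⊇ S vs w∈S , inj₂ xw
  greedyScan-dominates S (x ∷ vs) (here refl) | false =
    x , greedyScan-⊇ (S ++ [ x ]) vs (∈-++⁺ʳ S (here refl)) , inj₁ refl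

  greedyScan-excludes-dominating : ∀ S xs ys {u v} → IsStable G (_∈ S) → u ∈ xs → v ∉ S → v ∉ xs →
                                   ClosedNbhd G u ⊆ ClosedNbhd G v → v ∉ greedyScan G S (xs ++ ys)
  greedyScan-excludes-dominating S xs ys S-stable u∈xs v∉S v∉xs N[u]⊆N[v] v∈
    with greedyScan-dominates S xs u∈xs
  ... | w , w∈ , w∈N[u] with N[u]⊆N[v] w∈N[u] | greedyScan-⊆ S xs w∈
  ...   | inj₁ refl | inj₁ v∈S  = v∉S v∈S
  ...   | inj₁ refl | inj₂ v∈xs = v∉xs v∈xs
  ...   | inj₂ vw   | _         =
    greedyScan-stable S (xs ++ ys) S-stable _ _ v∈ w∈final vw
    where
    w∈final : w ∈ greedyScan G S (xs ++ ys)
    w∈final = subst (w ∈_) (sym (greedyScan-++ S xs ys)) (greedyScan-⊇ _ ys w∈)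

  greedySet-stable : ∀ σ → IsStable G (_∈ greedySet G σ)
  greedySet-stable σ = greedyScan-stable [] (map σ (allFin n)) (λ _ _ ())

  greedySet-dominates : ∀ {σ} → Injective _≡_ _≡_ σ → ∀ u → ∃ λ w → w ∈ greedySet G σ × ClosedNbhd G u w
  greedySet-dominates {σ} σ-inj u with injective⇒surjective σ-inj u
  ... | i , refl = greedyScan-dominates [] (map σ (allFin n)) (∈-map⁺ σ (∈-allFin i))

  greedySet-excludes-later-dominating : ∀ {σ} → Injective _≡_ _≡_ σ → ∀ {i j} → toℕ i < toℕ j →
                                        ClosedNbhd G (σ i) ⊆ ClosedNbhd G (σ j) → σ j ∉ greedySet G σ
  greedySet-excludes-later-dominating {σ} σ-inj {i} {j} i<j N[σi]⊆N[σj] σj∈ =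
    greedyScan-excludes-dominating [] prefix suffix (λ _ _ ()) (∈-take-tabulate⁺ σ i) (λ ()) σj∉prefix
      N[σi]⊆N[σj] (subst (σ j ∈_) split σj∈)
    where
    k : ℕ
    k = suc (toℕ i)
    prefix suffix : List (Fin n)
    prefix = take k (tabulate σ)
    suffix = drop k (tabulate σ)
    split : greedySet G σ ≡ greedyScan G [] (prefix ++ suffix)
    split = cong (greedyScan G []) (trans (map-tabulate id σ) (sym (take++drop≡id k (tabulate σ))))
    σj∉prefix : σ j ∉ prefix
    σj∉prefix σj∈prefix with ∈-take-tabulate⁻ σ k σj∈prefix
    ... | j′ , j′<k , σj≡σj′ with σ-inj σj≡σj′
    ...   | refl = <⇒≱ i<j (≤-pred j′<k)

  degree-<⇒index-< : ∀ {σ} → DegreeOrdering G σ → ∀ i j → degree G (σ i) < degree G (σ j) → toℕ i < toℕ j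
  degree-<⇒index-< {σ} (_ , mono) i j d< with <-cmp (toℕ i) (toℕ j)
  ... | tri< i<j _ _ = i<j
  ... | tri≈ _ i≡j _ = ⊥-elim (<-irrefl (cong (degree G ∘ σ) (toℕ-injective i≡j)) d<)
  ... | tri> _ _ j<i = ⊥-elim (<⇒≱ d< (mono j i j<i))

  greedySet-ClosedNbhd-⊆ : ∀ {σ} → DegreeOrdering G σ → ∀ {s v} → Simplicial G s → Adj G s v →
                           v ∈ greedySet G σ → ClosedNbhd G v ⊆ ClosedNbhd G s
  greedySet-ClosedNbhd-⊆ {σ} ord {s} {v} simp sv v∈ {x} x∈N[v] with ClosedNbhd? s x
  ... | yes x∈N[s] = x∈N[s]
  ... | no x∉N[s] with injective⇒surjective (proj₁ ord) s | injective⇒surjective (proj₁ ord) v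
  ...   | i , refl | j , refl = ⊥-elim (greedySet-excludes-later-dominating (proj₁ ord) i<j N[σi]⊆N[σj] v∈)
    where
    N[σi]⊆N[σj] : ClosedNbhd G (σ i) ⊆ ClosedNbhd G (σ j)
    N[σi]⊆N[σj] = Simplicial⇒ClosedNbhd-⊆ simp sv
    i<j : toℕ i < toℕ j
    i<j = degree-<⇒index-< ord i j (ClosedNbhd-⊂⇒degree-< N[σi]⊆N[σj] x∈N[v] x∉N[s])

  greedySet-simplicial : ∀ {σ} → DegreeOrdering G σ → (∀ u → ∃ λ C → SimplicialClique G C × C u) →
                         ∀ {v} → v ∈ greedySet G σ → Simplicial G v
  greedySet-simplicial ord covered {v} v∈ with covered v
  ... | C , (s , simp , C≐N[s]) , v∈C with proj₁ (C≐N[s] v) v∈C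
  ...   | inj₁ refl = simp
  ...   | inj₂ sv   = λ a b a∈N[v] b∈N[v] → simp a b (N[v]⊆N[s] a∈N[v]) (N[v]⊆N[s] b∈N[v])
    where
    N[v]⊆N[s] : ClosedNbhd G v ⊆ ClosedNbhd G s
    N[v]⊆N[s] = greedySet-ClosedNbhd-⊆ ord simp sv v∈

  greedySet-meets-SimplicialClique-once : ∀ {σ} → Injective _≡_ _≡_ σ → ∀ C → SimplicialClique G C →
    ∃ λ s → (s ∈ greedySet G σ × C s) × (∀ t → t ∈ greedySet G σ → C t → t ≡ s)
  greedySet-meets-SimplicialClique-once {σ} σ-inj C (s , simp , C≐N[s]) with greedySet-dominates σ-inj s
  ... | w , w∈ , w∈N[s] = w , (w∈ , proj₂ (C≐N[s] w) w∈N[s]) , unique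
    where
    unique : ∀ t → t ∈ greedySet G σ → C t → t ≡ w
    unique t t∈ t∈C with t ≟ w
    ... | yes t≡w = t≡w
    ... | no t≢w  = ⊥-elim (greedySet-stable σ t w t∈ w∈ (simp t w (proj₁ (C≐N[s] t) t∈C) w∈N[s] t≢w))

lemma9 : (n : ℕ) (G : Graph n) →
           (∀ u → ∃ λ C → SimplicialClique G C × C u) →
           (S : Fin n → Set) → DegreeGreedy G S →
           (∀ v → S v → Simplicial G v) ×
           (∀ C → SimplicialClique G C →
              ∃ λ s → (S s × C s) × (∀ t → S t → C t → t ≡ s))
lemma9 n G covered S (σ , ord , S≐greedy) = S-simplicial , S-meets-SimplicialClique-once
  where
  S-simplicial : ∀ v → S v → Simplicial G v
  S-simplicial v v∈S = greedySet-simplicial G ord covered (proj₁ (S≐greedy v) v∈S)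

  S-meets-SimplicialClique-once : ∀ C → SimplicialClique G C → ∃ λ s → (S s × C s) × (∀ t → S t → C t → t ≡ s)
  S-meets-SimplicialClique-once C C-simplicial
    with greedySet-meets-SimplicialClique-once G (proj₁ ord) C C-simplicial
  ... | s , (s∈ , s∈C) , unique =
    s , (proj₂ (S≐greedy s) s∈ , s∈C) , λ t t∈S t∈C → unique t (proj₁ (S≐greedy t) t∈S) t∈C
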